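{- Let $G_1$ be a reduced graph (as defined in the context) and let $H$ be any maximum path-cycle cover of $G_1$. Let $p$ be a path component of $H$ of length three exactly one of whose endpoints is a leaf of $G_1$. Then either some endpoint of $p$ is adjacent, via an edge of $G_1$, to a vertex not in $V(p)$, or there is a path $p'$ in $G_1$ of length three with $V(p')=V(p)$ such that some endpoint of $p'$ is adjacent, via an edge of $G_1$, to a vertex not in $V(p)$ (so that replacing $p$ by $p'$ in $H$ yields again a maximum path-cycle cover of $G_1$).
   Context: Throughout, $G_1$ is a connected undirected simple graph which is not a tree and which is reduced, meaning: (R1) every edge of $G_1$ whose two ends are each adjacent to a leaf (degree-$1$ vertex) of $G_1$ is a cut edge of $G_1$; (R2) no cut vertex of $G_1$ adjacent to a leaf of $G_1$ is super (a cut vertex is super if deleting it increases the number of connected components by at least $2$). Moreover it is assumed that no maximum path-cycle cover of $G_1$ consists of a single connected component. A path-cycle cover of $G_1$ is a spanning subgraph in which every vertex has degree at most $2$; it is maximum if it has the maximum number of edges among all path-cycle covers. Its connected components are path components and cycle components; the length of a path is its number of edges. A vertex of a path component is inner if its degree in the path is $2$ and an endpoint otherwise. -}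

module Defs where

open import Data.Nat using (ℕ; zero; suc; _+_; _≤_; _<ᵇ_)
open import Data.Fin using (Fin; toℕ)
open import Data.Bool using (Bool; true; false; if_then_else_; _∧_)
open import Data.List using (List; []; _∷_; _++_; [_]; length; map; allFin)
open import Data.Nat.ListAction using (sum)
open import Data.List.Relation.Unary.Unique.Propositional using (Unique)
open import Data.Product using (Σ; ∃; _×_; _,_)
open import Data.Sum using (_⊎_)
open import Relation.Binary.PropositionalEquality using (_≡_; _≢_)
open import Relation.Nullary using (¬_)

-- A (simple, undirected) graph on vertex set Fin n is given by a Bool-valued
-- adjacency function; simplicity = symmetric and irreflexive.
Adj : ℕ → Set
Adj n = Fin n → Fin n → Bool

Edge : ∀ {n} → Adj n → Fin n → Fin n → Set
Edge E u v = E u v ≡ true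

record IsSimple {n : ℕ} (E : Adj n) : Set where
  field
    sym   : ∀ u v → E u v ≡ E v u
    irrefl : ∀ u → E u u ≡ false

deg : ∀ {n} → Adj n → Fin n → ℕ
deg {n} R u = sum (map (λ v → if R u v then 1 else 0) (allFin n))

edgeCount : ∀ {n} → Adj n → ℕ
edgeCount {n} R =
  sum (map (λ u → sum (map (λ v → if (toℕ u <ᵇ toℕ v) ∧ R u v then 1 else 0) (allFin n)))
           (allFin n))

Leaf : ∀ {n} → Adj n → Fin n → Set
Leaf E u = deg E u ≡ 1

data Walk {n : ℕ} (S : Fin n → Set) (R : Fin n → Fin n → Set) : Fin n → Fin n → Set where
  here : ∀ {u} → S u → Walk S R u u
  step : ∀ {u v w} → S u → R u v → Walk S R v w → Walk S R u w

-- the graph (S , R) has exactly k connected components: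
-- k representatives, pairwise in different components, covering S.
HasComps : ∀ {n} → (Fin n → Set) → (Fin n → Fin n → Set) → ℕ → Set
HasComps {n} S R k =
  Σ (Fin k → Fin n) λ r →
    (∀ i → S (r i)) ×
    (∀ i j → Walk S R (r i) (r j) → i ≡ j) ×
    (∀ v → S v → ∃ λ i → Walk S R v (r i))

AllV : ∀ {n} → Fin n → Set
AllV _ = ⊤′
  where open import Data.Unit using () renaming (⊤ to ⊤′)

Comps : ∀ {n} → Adj n → ℕ → Set
Comps E k = HasComps AllV (Edge E) k

DelEdge : ∀ {n} → Adj n → Fin n → Fin n → Fin n → Fin n → Set
DelEdge E u v x y = Edge E x y × ¬ ((x ≡ u × y ≡ v) ⊎ (x ≡ v × y ≡ u))

CompsDelEdge : ∀ {n} → Adj n → Fin n → Fin n → ℕ → Set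
CompsDelEdge E u v k = HasComps AllV (DelEdge E u v) k

CompsDelVertex : ∀ {n} → Adj n → Fin n → ℕ → Set
CompsDelVertex E v k = HasComps (λ x → x ≢ v) (Edge E) k

Connected : ∀ {n} → Adj n → Set
Connected E = ∀ u v → Walk AllV (Edge E) u v

Chain : ∀ {n} → Adj n → List (Fin n) → Set
Chain E [] = ⊤′
  where open import Data.Unit using () renaming (⊤ to ⊤′)
Chain E (x ∷ []) = ⊤′
  where open import Data.Unit using () renaming (⊤ to ⊤′)
Chain E (x ∷ y ∷ xs) = Edge E x y × Chain E (y ∷ xs)

HasCycle : ∀ {n} → Adj n → Set
HasCycle {n} E = Σ (Fin n) λ x → Σ (List (Fin n)) λ xs →
  Unique (x ∷ xs) × 2 ≤ length xs × Chain E (x ∷ xs ++ [ x ])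

IsTree : ∀ {n} → Adj n → Set
IsTree E = Connected E × ¬ HasCycle E

IsCutEdge : ∀ {n} → Adj n → Fin n → Fin n → Set
IsCutEdge E u v = ∀ c c' → Comps E c → CompsDelEdge E u v c' → suc c ≤ c'

IsCutVertex : ∀ {n} → Adj n → Fin n → Set
IsCutVertex E v = ∀ c c' → Comps E c → CompsDelVertex E v c' → suc c ≤ c'

IsSuper : ∀ {n} → Adj n → Fin n → Set
IsSuper E v = IsCutVertex E v × (∀ c c' → Comps E c → CompsDelVertex E v c' → 2 + c ≤ c')

AdjToLeaf : ∀ {n} → Adj n → Fin n → Set
AdjToLeaf E u = ∃ λ l → Edge E u l × Leaf E l

record Reduced {n : ℕ} (E : Adj n) : Set where
  field
    R1 : ∀ u v → Edge E u v → AdjToLeaf E u → AdjToLeaf E v → IsCutEdge E u v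
    R2 : ∀ v → IsCutVertex E v → AdjToLeaf E v → ¬ IsSuper E v

record IsPCC {n : ℕ} (E : Adj n) (H : Adj n) : Set where
  field
    sym    : ∀ u v → H u v ≡ H v u
    sub    : ∀ u v → Edge H u v → Edge E u v
    deg≤2  : ∀ u → deg H u ≤ 2

IsMaxPCC : ∀ {n} → Adj n → Adj n → Set
IsMaxPCC E H = IsPCC E H × (∀ H' → IsPCC E H' → edgeCount H' ≤ edgeCount H)

Distinct4 : ∀ {n} → Fin n → Fin n → Fin n → Fin n → Set
Distinct4 a b c d = a ≢ b × a ≢ c × a ≢ d × b ≢ c × b ≢ d × c ≢ d

IsPathComp3 : ∀ {n} → Adj n → Fin n → Fin n → Fin n → Fin n → Set
IsPathComp3 H a b c d =
  Distinct4 a b c d × Edge H a b × Edge H b c × Edge H c d ×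
  deg H a ≡ 1 × deg H b ≡ 2 × deg H c ≡ 2 × deg H d ≡ 1

IsPath3 : ∀ {n} → Adj n → Fin n → Fin n → Fin n → Fin n → Set
IsPath3 E w x y z = Distinct4 w x y z × Edge E w x × Edge E x y × Edge E y z

In4 : ∀ {n} → Fin n → Fin n → Fin n → Fin n → Fin n → Set
In4 v a b c d = v ≡ a ⊎ v ≡ b ⊎ v ≡ c ⊎ v ≡ d

AdjOutside : ∀ {n} → Adj n → Fin n → Fin n → Fin n → Fin n → Fin n → Set
AdjOutside E e a b c d = ∃ λ v → Edge E e v × ¬ In4 v a b c d

-- Say a is the leaf end. If d has no neighbour outside p, then d, not being a leaf,
-- is adjacent to b, so a-b-d-c is another path on V(p); it works if c has a
-- neighbour outside p. Otherwise all neighbours of c and d lie in p, and a's only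
-- neighbour is b. A vertex outside p would then make {a}, {c, d} and the rest
-- three separate pieces of G − b, so b would be a super cut vertex next to the
-- leaf a, against (R2). Hence V(G₁) = V(p) and H = p is connected, which is excluded.
module Submission where

open import Defs
open import Data.Nat using (ℕ; zero; suc; _+_; _≤_; s≤s)
open import Data.Nat.Properties
  using (≤-trans; m≤m+n; n≤1+n; +-monoʳ-≤; +-identityʳ; +-0-commutativeMonoid; module ≤-Reasoning)
open import Data.Fin using (Fin; zero; suc; punchIn; punchOut)
open import Data.Fin.Properties
  using (_≟_; any?; injective⇒≤; punchInᵢ≢i; punchIn-punchOut)
open import Data.Bool using (true; false; if_then_else_)
import Data.Bool as Bool
open import Data.List using (tabulate)
open import Data.List.Properties using (map-tabulate)
open import Data.Nat.ListAction using (sum)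
open import Data.Product using (Σ; ∃; _×_; _,_; proj₁)
open import Data.Sum using (_⊎_; inj₁; inj₂)
import Data.Sum
open import Data.Unit using (tt)
open import Function using (_∘_)
open import Relation.Binary.Definitions using (Symmetric)
open import Relation.Nullary using (¬_; Dec; yes; no; contradiction)
open import Relation.Nullary.Decidable using (¬?; _⊎-dec_; _×-dec_; decidable-stable)
open import Relation.Binary.PropositionalEquality

open import Algebra.Properties.CommutativeMonoid.Sum +-0-commutativeMonoid
  using (sum-remove; sum-cong-≗; sum-replicate-zero) renaming (sum to ∑)

sum-tabulate : ∀ {n} (f : Fin n → ℕ) → sum (tabulate f) ≡ ∑ f
sum-tabulate {zero} f = refl
sum-tabulate {suc n} f = cong (f zero +_) (sum-tabulate (f ∘ suc))

∑-term≤ : ∀ {n} (f : Fin n → ℕ) i → f i ≤ ∑ f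
∑-term≤ {suc n} f i = subst (f i ≤_) (sym (sum-remove f)) (m≤m+n _ _)

∑-two-terms≤ : ∀ {n} (f : Fin n → ℕ) {i j} → i ≢ j → f i + f j ≤ ∑ f
∑-two-terms≤ {suc n} f {i} {j} i≢j = begin
  f i + f j                           ≡⟨ cong (λ k → f i + f k) (punchIn-punchOut i≢j) ⟨
  f i + f (punchIn i (punchOut i≢j))  ≤⟨ +-monoʳ-≤ (f i) (∑-term≤ (f ∘ punchIn i) _) ⟩
  f i + ∑ (f ∘ punchIn i)             ≡⟨ sum-remove f ⟨
  ∑ f                                 ∎
  where open ≤-Reasoning

∑-single-term : ∀ {n} (f : Fin n → ℕ) {i} → (∀ j → j ≢ i → f j ≡ 0) → ∑ f ≡ f i
∑-single-term {suc n} f {i} others-zero = begin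
  ∑ f                      ≡⟨ sum-remove f ⟩
  f i + ∑ (f ∘ punchIn i)  ≡⟨ cong (f i +_) (sum-cong-≗ (others-zero _ ∘ punchInᵢ≢i i)) ⟩
  f i + ∑ {n} (λ _ → 0)    ≡⟨ cong (f i +_) (sum-replicate-zero n) ⟩
  f i + 0                  ≡⟨ +-identityʳ (f i) ⟩
  f i                      ∎
  where open ≡-Reasoning

module _ {n} {E : Adj n} {u : Fin n} where

  private
    𝟙[u~_] : Fin n → ℕ
    𝟙[u~ v ] = if E u v then 1 else 0

  deg≡∑ : deg E u ≡ ∑ 𝟙[u~_]
  deg≡∑ = trans (cong sum (map-tabulate {n = n} (λ v → v) 𝟙[u~_])) (sum-tabulate 𝟙[u~_])

  two-neighbours⇒2≤deg : ∀ {v w} → Edge E u v → Edge E u w → v ≢ w → 2 ≤ deg E u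
  two-neighbours⇒2≤deg {v} {w} uv uw v≢w = begin
    2                      ≡⟨ cong₂ (λ x y → (if x then 1 else 0) + (if y then 1 else 0)) uv uw ⟨
    𝟙[u~ v ] + 𝟙[u~ w ]    ≤⟨ ∑-two-terms≤ 𝟙[u~_] v≢w ⟩
    ∑ 𝟙[u~_]               ≡⟨ deg≡∑ ⟨
    deg E u                ∎
    where open ≤-Reasoning

  unique-neighbour⇒leaf : ∀ {v} → Edge E u v → (∀ w → Edge E u w → w ≡ v) → Leaf E u
  unique-neighbour⇒leaf {v} uv unique = begin
    deg E u     ≡⟨ deg≡∑ ⟩
    ∑ 𝟙[u~_]    ≡⟨ ∑-single-term 𝟙[u~_] non-neighbours ⟩
    𝟙[u~ v ]    ≡⟨ cong (λ x → if x then 1 else 0) uv ⟩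
    1           ∎
    where
    open ≡-Reasoning
    non-neighbours : ∀ w → w ≢ v → 𝟙[u~ w ] ≡ 0
    non-neighbours w w≢v with E u w in uw
    ... | true  = contradiction (unique w uw) w≢v
    ... | false = refl

  leaf⇒unique-neighbour : Leaf E u → ∀ {v w} → Edge E u v → Edge E u w → w ≡ v
  leaf⇒unique-neighbour leaf {v} {w} uv uw with w ≟ v
  ... | yes w≡v = w≡v
  ... | no  w≢v = contradiction (subst (2 ≤_) leaf (two-neighbours⇒2≤deg uw uv w≢v)) λ { (s≤s ()) }

  ¬leaf⇒other-neighbour : ¬ Leaf E u → ∀ {v} → Edge E u v → ∃ λ w → Edge E u w × w ≢ v
  ¬leaf⇒other-neighbour ¬leaf {v} uv with any? (λ w → (E u w Bool.≟ true) ×-dec ¬? (w ≟ v))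
  ... | yes other = other
  ... | no  none  = contradiction
    (unique-neighbour⇒leaf uv (λ w uw → decidable-stable (w ≟ v) (λ w≢v → none (w , uw , w≢v))))
    ¬leaf

module _ {n} {S : Fin n → Set} {R : Fin n → Fin n → Set} where

  walk-source : ∀ {u w} → Walk S R u w → S u
  walk-source (here su)     = su
  walk-source (step su _ _) = su

  Closed : (Fin n → Set) → Set
  Closed C = ∀ {u v} → S u → S v → R u v → C u → C v

  closed-forward : ∀ {C u w} → Closed C → Walk S R u w → C u → C w
  closed-forward cl (here _)        cu = cu
  closed-forward cl (step su uv vw) cu = closed-forward cl vw (cl su (walk-source vw) uv cu)

  closed-backward : ∀ {C u w} → Symmetric R → Closed C → Walk S R u w → C w → C u
  closed-backward R-sym cl (here _)        cw = cw
  closed-backward R-sym cl (step su uv vw) cw =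
    cl (walk-source vw) su (R-sym uv) (closed-backward R-sym cl vw cw)

  Separated : Fin n → Fin n → Set₁
  Separated x y = Σ (Fin n → Set) λ C → Closed C × C x × ¬ C y

  separated⇒no-common-reach : Symmetric R → ∀ {x y w} → Separated x y →
                              Walk S R x w → ¬ Walk S R y w
  separated⇒no-common-reach R-sym (C , cl , cx , ¬cy) xw yw =
    ¬cy (closed-backward R-sym cl yw (closed-forward cl xw cx))

  three-separated⇒3≤comps : Symmetric R → ∀ {k x y z} → HasComps S R k → S x → S y → S z →
                            Separated x y → Separated x z → Separated y z → 3 ≤ k
  three-separated⇒3≤comps R-sym {k} (r , _ , _ , cover) sx sy sz x∣y x∣z y∣z
    with cover _ sx | cover _ sy | cover _ sz
  ... | i , x⇝ | j , y⇝ | l , z⇝ = injective⇒≤ {f = pick} pick-injective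
    where
    pick : Fin 3 → Fin k
    pick zero             = i
    pick (suc zero)       = j
    pick (suc (suc zero)) = l

    apart : ∀ {x y i j} → Separated x y → Walk S R x (r i) → Walk S R y (r j) → i ≢ j
    apart x∣y x⇝ y⇝ refl = separated⇒no-common-reach R-sym x∣y x⇝ y⇝

    pick-injective : ∀ {p q} → pick p ≡ pick q → p ≡ q
    pick-injective {zero}            {zero}             _ = refl
    pick-injective {zero}            {suc zero}         e = contradiction e (apart x∣y x⇝ y⇝)
    pick-injective {zero}            {suc (suc zero)}   e = contradiction e (apart x∣z x⇝ z⇝)
    pick-injective {suc zero}        {zero}             e = contradiction (sym e) (apart x∣y x⇝ y⇝)
    pick-injective {suc zero}        {suc zero}         _ = refl
    pick-injective {suc zero}        {suc (suc zero)}   e = contradiction e (apart y∣z y⇝ z⇝)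
    pick-injective {suc (suc zero)}  {zero}             e = contradiction (sym e) (apart x∣z x⇝ z⇝)
    pick-injective {suc (suc zero)}  {suc zero}         e = contradiction (sym e) (apart y∣z y⇝ z⇝)
    pick-injective {suc (suc zero)}  {suc (suc zero)}   _ = refl

connected⇒comps≤1 : ∀ {n} {E : Adj n} {k} → Connected E → Comps E k → k ≤ 1
connected⇒comps≤1 conn (r , _ , apart , _) =
  injective⇒≤ {f = λ _ → zero} λ {i} {j} _ → apart i j (conn (r i) (r j))

three-pieces⇒super : ∀ {n} {E : Adj n} {v} → Connected E →
                     (∀ k → CompsDelVertex E v k → 3 ≤ k) → IsSuper E v
three-pieces⇒super {E = E} {v} conn three = (λ c c' cc cc' → ≤-trans (n≤1+n _) (gain c c' cc cc')) , gain
  where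
  gain : ∀ c c' → Comps E c → CompsDelVertex E v c' → 2 + c ≤ c'
  gain c c' cc cc' = ≤-trans (+-monoʳ-≤ 2 (connected⇒comps≤1 conn cc)) (three c' cc')

module _ {n} {v a b c d : Fin n} where

  In4-swap₃₄ : In4 v a b c d → In4 v a b d c
  In4-swap₃₄ (inj₁ v≡a)                = inj₁ v≡a
  In4-swap₃₄ (inj₂ (inj₁ v≡b))         = inj₂ (inj₁ v≡b)
  In4-swap₃₄ (inj₂ (inj₂ (inj₁ v≡c)))  = inj₂ (inj₂ (inj₂ v≡c))
  In4-swap₃₄ (inj₂ (inj₂ (inj₂ v≡d)))  = inj₂ (inj₂ (inj₁ v≡d))

  In4-reverse : In4 v a b c d → In4 v d c b a
  In4-reverse (inj₁ v≡a)                = inj₂ (inj₂ (inj₂ v≡a))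
  In4-reverse (inj₂ (inj₁ v≡b))         = inj₂ (inj₂ (inj₁ v≡b))
  In4-reverse (inj₂ (inj₂ (inj₁ v≡c)))  = inj₂ (inj₁ v≡c)
  In4-reverse (inj₂ (inj₂ (inj₂ v≡d)))  = inj₁ v≡d

In4? : ∀ {n} (v a b c d : Fin n) → Dec (In4 v a b c d)
In4? v a b c d = (v ≟ a) ⊎-dec (v ≟ b) ⊎-dec (v ≟ c) ⊎-dec (v ≟ d)

AdjOutside? : ∀ {n} (E : Adj n) e a b c d → Dec (AdjOutside E e a b c d)
AdjOutside? E e a b c d = any? (λ v → (E e v Bool.≟ true) ×-dec ¬? (In4? v a b c d))

¬AdjOutside⇒neighbours-inside : ∀ {n} {E : Adj n} {e a b c d} → ¬ AdjOutside E e a b c d →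
                               ∀ v → Edge E e v → In4 v a b c d
¬AdjOutside⇒neighbours-inside {a = a} {b} {c} {d} trapped v ev =
  decidable-stable (In4? v a b c d) (λ v∉p → trapped (v , ev , v∉p))

AdjOutside-reverse : ∀ {n} {E : Adj n} {e a b c d} → AdjOutside E e d c b a → AdjOutside E e a b c d
AdjOutside-reverse (v , ev , v∉p) = v , ev , v∉p ∘ In4-reverse

HasExit : ∀ {n} → Adj n → (a b c d : Fin n) → Set
HasExit {n} G a b c d =
  (AdjOutside G a a b c d ⊎ AdjOutside G d a b c d)
  ⊎ (Σ (Fin n) λ w → Σ (Fin n) λ x → Σ (Fin n) λ y → Σ (Fin n) λ z →
       IsPath3 G w x y z ×
       (∀ v → In4 v w x y z → In4 v a b c d) ×
       (∀ v → In4 v a b c d → In4 v w x y z) ×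
       (AdjOutside G w a b c d ⊎ AdjOutside G z a b c d))

HasExit-reverse : ∀ {n} {G : Adj n} {a b c d} → HasExit G d c b a → HasExit G a b c d
HasExit-reverse {G = G} (inj₁ (inj₁ d-exits)) = inj₁ (inj₂ (AdjOutside-reverse {E = G} d-exits))
HasExit-reverse {G = G} (inj₁ (inj₂ a-exits)) = inj₁ (inj₁ (AdjOutside-reverse {E = G} a-exits))
HasExit-reverse {G = G} (inj₂ (w , x , y , z , path , ⊆p , p⊆ , exit)) =
  inj₂ (w , x , y , z , path , (λ v → In4-reverse ∘ ⊆p v) , (λ v → p⊆ v ∘ In4-reverse) , reverse-exit exit)
  where
  reverse-exit = Data.Sum.map (AdjOutside-reverse {E = G}) (AdjOutside-reverse {E = G})

Distinct4-reverse : ∀ {n} {a b c d : Fin n} → Distinct4 a b c d → Distinct4 d c b a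
Distinct4-reverse (a≢b , a≢c , a≢d , b≢c , b≢d , c≢d) =
  ≢-sym c≢d , ≢-sym b≢d , ≢-sym a≢d , ≢-sym b≢c , ≢-sym a≢c , ≢-sym a≢b

IsPathComp3-reverse : ∀ {n} {H : Adj n} → Symmetric (Edge H) →
                      ∀ {a b c d} → IsPathComp3 H a b c d → IsPathComp3 H d c b a
IsPathComp3-reverse H-sym (distinct , ab , bc , cd , deg-a , deg-b , deg-c , deg-d) =
  Distinct4-reverse distinct , H-sym cd , H-sym bc , H-sym ab , deg-d , deg-c , deg-b , deg-a

spanning-path3⇒connected : ∀ {n} {H : Adj n} → Symmetric (Edge H) → ∀ {a b c d} →
                           Edge H a b → Edge H b c → Edge H c d → (∀ v → In4 v a b c d) → Comps H 1
spanning-path3⇒connected {H = H} H-sym {a} {b} {c} {d} ab bc cd spans =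
  (λ _ → a) , (λ _ → tt) , (λ { zero zero _ → refl }) , λ v _ → zero , walk-to-a v (spans v)
  where
  a⇝a : Walk AllV (Edge H) a a
  a⇝a = here tt
  b⇝a : Walk AllV (Edge H) b a
  b⇝a = step tt (H-sym ab) a⇝a
  c⇝a : Walk AllV (Edge H) c a
  c⇝a = step tt (H-sym bc) b⇝a

  walk-to-a : ∀ v → In4 v a b c d → Walk AllV (Edge H) v a
  walk-to-a _ (inj₁ refl)                = a⇝a
  walk-to-a _ (inj₂ (inj₁ refl))         = b⇝a
  walk-to-a _ (inj₂ (inj₂ (inj₁ refl)))  = c⇝a
  walk-to-a _ (inj₂ (inj₂ (inj₂ refl)))  = step tt (H-sym cd) c⇝a

simple⇒symmetric : ∀ {n} {E : Adj n} → IsSimple E → Symmetric (Edge E)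
simple⇒symmetric simple {u} {v} uv = trans (IsSimple.sym simple v u) uv

simple⇒loopless : ∀ {n} {E : Adj n} → IsSimple E → ∀ {u} → ¬ Edge E u u
simple⇒loopless simple {u} uu with trans (sym uu) (IsSimple.irrefl simple u)
... | ()

pcc⇒symmetric : ∀ {n} {E H : Adj n} → IsPCC E H → Symmetric (Edge H)
pcc⇒symmetric pcc {u} {v} uv = trans (IsPCC.sym pcc v u) uv

module LeafEnd {n} {G H : Adj n} (G-simple : IsSimple G) (G-connected : Connected G)
               (G-reduced : Reduced G) (H-pcc : IsPCC G H) (H-disconnected : ¬ Comps H 1)
               {a b c d : Fin n} (a≢b : a ≢ b) (a≢c : a ≢ c) (a≢d : a ≢ d)
               (b≢c : b ≢ c) (b≢d : b ≢ d) (c≢d : c ≢ d)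
               (ab : Edge H a b) (bc : Edge H b c) (cd : Edge H c d)
               (a-leaf : Leaf G a) (d-nonleaf : ¬ Leaf G d) where

  G-sym : Symmetric (Edge G)
  G-sym = simple⇒symmetric G-simple

  G-ab : Edge G a b
  G-ab = IsPCC.sub H-pcc a b ab

  G-cd : Edge G c d
  G-cd = IsPCC.sub H-pcc c d cd

  a-neighbour : ∀ {v} → Edge G a v → v ≡ b
  a-neighbour = leaf⇒unique-neighbour {E = G} a-leaf G-ab

  d~b : ¬ AdjOutside G d a b c d → Edge G d b
  d~b d-trapped with ¬leaf⇒other-neighbour {E = G} d-nonleaf (G-sym G-cd)
  ... | v , dv , v≢c with ¬AdjOutside⇒neighbours-inside {E = G} d-trapped v dv
  ... | inj₁ refl                 = contradiction (a-neighbour (G-sym dv)) (≢-sym b≢d)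
  ... | inj₂ (inj₁ refl)          = dv
  ... | inj₂ (inj₂ (inj₁ refl))   = contradiction refl v≢c
  ... | inj₂ (inj₂ (inj₂ refl))   = contradiction dv (simple⇒loopless G-simple)

  rerouted : Edge G d b → AdjOutside G c a b c d → HasExit G a b c d
  rerouted db c-exits =
    inj₂ (a , b , d , c , path-abdc , (λ _ → In4-swap₃₄) , (λ _ → In4-swap₃₄) , inj₂ c-exits)
    where
    path-abdc : IsPath3 G a b d c
    path-abdc = (a≢b , a≢d , a≢c , b≢d , b≢c , ≢-sym c≢d) , G-ab , G-sym db , G-sym G-cd

  a-closed : Closed {S = _≢ b} {R = Edge G} (_≡ a)
  a-closed _ v≢b av refl = contradiction (a-neighbour av) v≢b

  cd-closed : ¬ AdjOutside G c a b c d → ¬ AdjOutside G d a b c d →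
              Closed {S = _≢ b} {R = Edge G} (λ u → u ≡ c ⊎ u ≡ d)
  cd-closed c-trapped d-trapped {u} {v} u≢b v≢b uv u∈cd = stays (neighbour-inside u∈cd)
    where
    neighbour-inside : u ≡ c ⊎ u ≡ d → In4 v a b c d
    neighbour-inside (inj₁ refl) = ¬AdjOutside⇒neighbours-inside {E = G} c-trapped v uv
    neighbour-inside (inj₂ refl) = ¬AdjOutside⇒neighbours-inside {E = G} d-trapped v uv

    stays : In4 v a b c d → v ≡ c ⊎ v ≡ d
    stays (inj₁ refl)        = contradiction (a-neighbour (G-sym uv)) u≢b
    stays (inj₂ (inj₁ v≡b))  = contradiction v≡b v≢b
    stays (inj₂ (inj₂ v∈cd)) = v∈cd

  b-super : ¬ AdjOutside G c a b c d → ¬ AdjOutside G d a b c d →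
            ∀ {x} → ¬ In4 x a b c d → IsSuper G b
  b-super c-trapped d-trapped x∉p = three-pieces⇒super G-connected λ k pieces →
    three-separated⇒3≤comps G-sym pieces a≢b (≢-sym b≢c) (x∉p ∘ inj₂ ∘ inj₁)
      (_ , a-closed , refl , ≢-sym a≢c)
      (_ , a-closed , refl , x∉p ∘ inj₁)
      (_ , cd-closed c-trapped d-trapped , inj₁ refl , x∉p ∘ inj₂ ∘ inj₂)

  has-exit : HasExit G a b c d
  has-exit with AdjOutside? G d a b c d
  ... | yes d-exits = inj₁ (inj₂ d-exits)
  ... | no d-trapped with AdjOutside? G c a b c d
  ...   | yes c-exits = rerouted (d~b d-trapped) c-exits
  ...   | no c-trapped with any? (λ x → ¬? (In4? x a b c d))
  ...     | yes (x , x∉p) =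
    contradiction super (Reduced.R2 G-reduced b (proj₁ super) (a , G-sym G-ab , a-leaf))
    where super = b-super c-trapped d-trapped x∉p
  ...     | no spans = contradiction
    (spanning-path3⇒connected (pcc⇒symmetric H-pcc) ab bc cd
      (λ v → decidable-stable (In4? v a b c d) (λ v∉p → spans (v , v∉p))))
    H-disconnected

leaf-end-has-exit : ∀ {n} {G H : Adj n} → IsSimple G → Connected G → Reduced G → IsPCC G H → ¬ Comps H 1 →
                    ∀ {a b c d} → IsPathComp3 H a b c d → Leaf G a → ¬ Leaf G d → HasExit G a b c d
leaf-end-has-exit G-simple G-connected G-reduced H-pcc H-disconnected
  ((a≢b , a≢c , a≢d , b≢c , b≢d , c≢d) , ab , bc , cd , _) =
  LeafEnd.has-exit G-simple G-connected G-reduced H-pcc H-disconnected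
    a≢b a≢c a≢d b≢c b≢d c≢d ab bc cd

lemma9 : (n : ℕ) (G₁ : Adj n) → IsSimple G₁ → Connected G₁ → ¬ IsTree G₁ → Reduced G₁ →
         (∀ H → IsMaxPCC G₁ H → ¬ Comps H 1) →
         (H : Adj n) → IsMaxPCC G₁ H →
         (a b c d : Fin n) → IsPathComp3 H a b c d →
         ((Leaf G₁ a × ¬ Leaf G₁ d) ⊎ (¬ Leaf G₁ a × Leaf G₁ d)) →
         (AdjOutside G₁ a a b c d ⊎ AdjOutside G₁ d a b c d)
         ⊎ (Σ (Fin n) λ w → Σ (Fin n) λ x → Σ (Fin n) λ y → Σ (Fin n) λ z →
              IsPath3 G₁ w x y z ×
              (∀ v → In4 v w x y z → In4 v a b c d) ×
              (∀ v → In4 v a b c d → In4 v w x y z) ×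
              (AdjOutside G₁ w a b c d ⊎ AdjOutside G₁ z a b c d))
lemma9 n G simple connected _ reduced no-connected-max H H-max a b c d p (inj₁ (a-leaf , d-nonleaf)) =
  leaf-end-has-exit simple connected reduced (proj₁ H-max) (no-connected-max H H-max) p a-leaf d-nonleaf
lemma9 n G simple connected _ reduced no-connected-max H H-max a b c d p (inj₂ (a-nonleaf , d-leaf)) =
  HasExit-reverse (leaf-end-has-exit simple connected reduced (proj₁ H-max) (no-connected-max H H-max)
    (IsPathComp3-reverse (pcc⇒symmetric (proj₁ H-max)) p) d-leaf a-nonleaf)
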